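{- Let $\Gamma$ be a graph in $NG(v,k,\lambda;m,s)$ with $k-\lambda-s+m-1=0$ and $m=1$. Then $\Gamma$ is isomorphic to the square lattice graph $L_{2}(s)$.
   Context: All graphs are finite, simple and undirected. A graph on $v$ vertices is edge-regular with parameters $(v,k,\lambda)$ if it has at least one edge, is $k$-regular, and every two adjacent vertices have exactly $\lambda$ common neighbours. A clique $S$ in a regular graph is $m$-regular if every vertex not in $S$ is adjacent to exactly $m>0$ vertices of $S$; an $s$-clique is a clique of size $s$. $NG(v,k,\lambda;m,s)$ denotes the set of non-complete edge-regular graphs with parameters $(v,k,\lambda)$ that contain an $m$-regular $s$-clique with $s\geq 2$. The square lattice graph $L_2(n)$ has vertex set $\{1,\dots,n\}^2$, two distinct vertices adjacent iff they agree in one coordinate. -}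

module Defs where

open import Data.Nat using (ℕ; zero; suc; _+_; _∸_; _≥_; _>_)
open import Data.Fin using (Fin)
open import Data.Fin.Subset using (Subset; _∈_; _∉_; ∣_∣)
open import Data.Product using (Σ; ∃; ∃-syntax; _×_; _,_)
open import Data.Sum using (_⊎_)
open import Relation.Nullary using (¬_; Dec; yes; no)
open import Relation.Unary using (Pred; Decidable)
open import Relation.Binary.PropositionalEquality using (_≡_; _≢_)
open import Function.Bundles using (_⤖_; Bijection)
open import Level using (0ℓ)
open import Data.Fin.Subset.Properties using (_∈?_)

count : ∀ {n} {P : Pred (Fin n) 0ℓ} → Decidable P → ℕ
count {zero} P? = 0
count {suc n} P? with P? Data.Fin.zero
... | yes _ = suc (count {n} (λ i → P? (Data.Fin.suc i)))
... | no  _ = count {n} (λ i → P? (Data.Fin.suc i))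

record Graph (v : ℕ) : Set₁ where
  field
    Adj    : Fin v → Fin v → Set
    adj?   : ∀ x y → Dec (Adj x y)
    sym    : ∀ {x y} → Adj x y → Adj y x
    irrefl : ∀ {x} → ¬ Adj x x
open Graph public

module _ {v : ℕ} (Γ : Graph v) where

  degree : Fin v → ℕ
  degree x = count (adj? Γ x)

  commonNbrs : Fin v → Fin v → ℕ
  commonNbrs x y = count (λ z → adj?2 z)
    where
    adj?2 : ∀ z → Dec (Adj Γ x z × Adj Γ y z)
    adj?2 z with adj? Γ x z | adj? Γ y z
    ... | yes p | yes q = yes (p , q)
    ... | no ¬p | _     = no (λ { (p , _) → ¬p p })
    ... | yes _ | no ¬q = no (λ { (_ , q) → ¬q q })

  IsRegular : ℕ → Set
  IsRegular k = ∀ x → degree x ≡ k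

  IsEdgeRegular : ℕ → ℕ → Set
  IsEdgeRegular k lam =
    (∃[ x ] ∃[ y ] Adj Γ x y) ×
    IsRegular k ×
    (∀ x y → Adj Γ x y → commonNbrs x y ≡ lam)

  IsComplete : Set
  IsComplete = ∀ x y → x ≢ y → Adj Γ x y

  IsClique : Subset v → Set
  IsClique S = ∀ x y → x ∈ S → y ∈ S → x ≢ y → Adj Γ x y

  nbrsIn : Subset v → Fin v → ℕ
  nbrsIn S x = count (λ z → dec z)
    where
    dec : ∀ z → Dec (z ∈ S × Adj Γ x z)
    dec z with z ∈? S | adj? Γ x z
    ... | yes p | yes q = yes (p , q)
    ... | no ¬p | _     = no (λ { (p , _) → ¬p p })
    ... | yes _ | no ¬q = no (λ { (_ , q) → ¬q q })

  IsMRegularClique : ℕ → Subset v → Set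
  IsMRegularClique m S =
    IsClique S × m > 0 × (∀ x → x ∉ S → nbrsIn S x ≡ m)

  InNG : ℕ → ℕ → ℕ → ℕ → Set
  InNG k lam m s =
    ¬ IsComplete × IsEdgeRegular k lam × s ≥ 2 ×
    (∃[ S ] (IsMRegularClique m S × ∣ S ∣ ≡ s))

L2Adj : ∀ {n} → (Fin n × Fin n) → (Fin n × Fin n) → Set
L2Adj (a , b) (c , d) = (a ≡ c × b ≢ d) ⊎ (a ≢ c × b ≡ d)

IsoToL2 : ∀ {v} → Graph v → ℕ → Set
IsoToL2 {v} Γ n =
  Σ (Fin v ⤖ (Fin n × Fin n)) λ f →
    ∀ x y → (Adj Γ x y → L2Adj (Bijection.to f x) (Bijection.to f y)) ×
            (L2Adj (Bijection.to f x) (Bijection.to f y) → Adj Γ x y)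

module Submission where

-- Let S be the 1-regular s-clique.  Two vertices of S have as common neighbours exactly
-- the other vertices of S, so s = λ + 2 and k = 2λ + 2.  Each x ∈ S thus has λ + 1
-- neighbours outside S; with x they form the "row" of x, a clique of size s, and the
-- rows partition the vertex set.  A vertex sees at most one vertex of any other row
-- (else the two would have λ + 1 common neighbours), so by counting it sees exactly one
-- vertex of each other row, and two of its neighbours in distinct further rows are
-- adjacent.  Hence "equal, or adjacent in different rows" is an equivalence relation,
-- whose classes (the columns) each meet a fixed row once.  Numbering rows and columns by
-- Fin s gives the isomorphism with L₂(s).

open import Data.Nat using (ℕ; zero; suc; _+_; _≤_; _<_; z≤n; s≤s; s≤s⁻¹)
open import Data.Nat.Properties
  using ( ≤-antisym; ≤-trans; ≤-reflexive; m≤n⇒m≤1+n; suc-injective; 1+n≰n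
        ; +-suc; +-cancelˡ-≡; +-cancelʳ-≡; +-commutativeSemigroup; module ≤-Reasoning)
open import Algebra.Properties.CommutativeSemigroup +-commutativeSemigroup using (interchange)
open import Data.Fin using (Fin; zero; suc; _≟_)
open import Data.Fin.Properties using (any?; pigeonhole; <⇒≢)
import Data.Fin.Properties as Fin
open import Data.Fin.Subset using (Subset; _∈_; _∉_; ∣_∣)
open import Data.Fin.Subset.Properties using (_∈?_; drop-there)
open import Data.Vec using (_∷_; [])
open import Data.Vec.Base using (there)
open import Data.Bool using (true; false)
open import Data.Product using (∃; ∃₂; _×_; _,_; proj₁; proj₂; map; map₁; map₂)
open import Data.Sum using (_⊎_; inj₁; inj₂) renaming (map to map⊎)
open import Function using (_∘_)
open import Function.Bundles using (mk⤖)
open import Relation.Nullary using (¬_; Dec; yes; no; ¬?; contradiction)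
open import Relation.Nullary.Decidable using (_×-dec_; _⊎-dec_)
open import Relation.Unary using (Pred; Decidable; _⊆_; _∩_; ∁)
open import Relation.Unary.Properties using (_∩?_; ∁?)
open import Relation.Binary.PropositionalEquality
open import Level using (0ℓ)
open import Defs hiding (sym)

private variable
  n m c : ℕ

indicator : {A : Set} → Dec A → ℕ
indicator (yes _) = 1
indicator (no _)  = 0

count-suc : {P : Pred (Fin (suc n)) 0ℓ} (P? : Decidable P) →
  count P? ≡ indicator (P? zero) + count (P? ∘ suc)
count-suc P? with P? zero
... | yes _ = refl
... | no _  = refl

indicator-split : {A B : Set} (a : Dec A) (b : Dec B) →
  indicator a ≡ indicator (a ×-dec b) + indicator (a ×-dec (¬? b))
indicator-split (yes _) (yes _) = refl
indicator-split (yes _) (no _)  = refl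
indicator-split (no _)  (yes _) = refl
indicator-split (no _)  (no _)  = refl

count-mono : {P Q : Pred (Fin n) 0ℓ} (P? : Decidable P) (Q? : Decidable Q) →
  P ⊆ Q → count P? ≤ count Q?
count-mono {n = zero}  _  _  _   = z≤n
count-mono {n = suc _} P? Q? P⊆Q with P? zero | Q? zero
... | yes _ | yes _  = s≤s (count-mono (P? ∘ suc) (Q? ∘ suc) P⊆Q)
... | yes p | no ¬q  = contradiction (P⊆Q p) ¬q
... | no _  | yes _  = m≤n⇒m≤1+n (count-mono (P? ∘ suc) (Q? ∘ suc) P⊆Q)
... | no _  | no _   = count-mono (P? ∘ suc) (Q? ∘ suc) P⊆Q

count-cong : {P Q : Pred (Fin n) 0ℓ} (P? : Decidable P) (Q? : Decidable Q) →
  P ⊆ Q → Q ⊆ P → count P? ≡ count Q?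
count-cong P? Q? P⊆Q Q⊆P = ≤-antisym (count-mono P? Q? P⊆Q) (count-mono Q? P? Q⊆P)

count-split : {P Q : Pred (Fin n) 0ℓ} (P? : Decidable P) (Q? : Decidable Q) →
  count P? ≡ count (P? ∩? Q?) + count (P? ∩? ∁? Q?)
count-split {n = zero}  _  _  = refl
count-split {n = suc _} P? Q? = begin
  count P?
    ≡⟨ count-suc P? ⟩
  indicator (P? zero) + count (P? ∘ suc)
    ≡⟨ cong₂ _+_ (indicator-split (P? zero) (Q? zero)) (count-split (P? ∘ suc) (Q? ∘ suc)) ⟩
  (indicator ((P? ∩? Q?) zero) + indicator ((P? ∩? ∁? Q?) zero)) +
    (count ((P? ∩? Q?) ∘ suc) + count ((P? ∩? ∁? Q?) ∘ suc))
    ≡⟨ interchange (indicator ((P? ∩? Q?) zero)) (indicator ((P? ∩? ∁? Q?) zero))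
                   (count ((P? ∩? Q?) ∘ suc)) (count ((P? ∩? ∁? Q?) ∘ suc)) ⟩
  (indicator ((P? ∩? Q?) zero) + count ((P? ∩? Q?) ∘ suc)) +
    (indicator ((P? ∩? ∁? Q?) zero) + count ((P? ∩? ∁? Q?) ∘ suc))
    ≡⟨ sym (cong₂ _+_ (count-suc (P? ∩? Q?)) (count-suc (P? ∩? ∁? Q?))) ⟩
  count (P? ∩? Q?) + count (P? ∩? ∁? Q?) ∎
  where open ≡-Reasoning

count-witness : {P : Pred (Fin n) 0ℓ} (P? : Decidable P) → 0 < count P? → ∃ P
count-witness {n = suc _} P? pos with P? zero
... | yes p = zero , p
... | no _  with z , pz ← count-witness (P? ∘ suc) pos = suc z , pz

count-empty : {P : Pred (Fin n) 0ℓ} (P? : Decidable P) → (∀ z → ¬ P z) → count P? ≡ 0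
count-empty {n = zero}  _  _     = refl
count-empty {n = suc _} P? empty with P? zero
... | yes p = contradiction p (empty zero)
... | no _  = count-empty (P? ∘ suc) (empty ∘ suc)

count-singleton : (a : Fin n) → count (_≟ a) ≡ 1
count-singleton {suc n} zero    = cong suc (count-empty (λ (z : Fin n) → suc z ≟ zero) (λ _ ()))
count-singleton {suc n} (suc a) =
  trans (count-cong (λ z → suc z ≟ suc a) (_≟ a) Fin.suc-injective (cong suc)) (count-singleton a)

_-[_] : {P : Pred (Fin n) 0ℓ} → Decidable P → (a : Fin n) → Decidable (P ∩ ∁ (_≡ a))
P? -[ a ] = P? ∩? ∁? (_≟ a)

infixl 6 _-[_]

count-remove : {P : Pred (Fin n) 0ℓ} (P? : Decidable P) {a : Fin n} → P a →
  count P? ≡ suc (count (P? -[ a ]))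
count-remove P? {a} pa =
  trans (count-split P? (_≟ a))
        (cong (_+ count (P? -[ a ]))
              (trans (count-cong (P? ∩? (_≟ a)) (_≟ a) (λ (_ , z≡a) → z≡a) (λ { refl → pa , refl }))
                     (count-singleton a)))

count-unique : {P : Pred (Fin n) 0ℓ} (P? : Decidable P) → count P? ≡ 1 →
  ∀ {a b} → P a → P b → a ≡ b
count-unique P? one {a} {b} pa pb with b ≟ a
... | yes b≡a = sym b≡a
... | no b≢a  = contradiction (trans (sym (count-remove (P? -[ a ]) (pb , b≢a)))
                                      (suc-injective (trans (sym (count-remove P? pa)) one)))
                              λ ()

∣∣≡count : (S : Subset n) → ∣ S ∣ ≡ count (_∈? S)
∣∣≡count []          = refl
∣∣≡count (true ∷ S)  = cong suc (trans (∣∣≡count S) (count-cong (_∈? S) (λ z → suc z ∈? (true ∷ S)) there drop-there))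
∣∣≡count (false ∷ S) = trans (∣∣≡count S) (count-cong (_∈? S) (λ z → suc z ∈? (false ∷ S)) there drop-there)

record Enumeration (P : Pred (Fin n) 0ℓ) (c : ℕ) : Set where
  field
    elem           : Fin c → Fin n
    elem∈          : ∀ i → P (elem i)
    elem-injective : ∀ {i j} → elem i ≡ elem j → i ≡ j
    index          : ∀ z → P z → Fin c
    elem-index     : ∀ z (pz : P z) → elem (index z pz) ≡ z

  index-of-elem : ∀ {z i} (pz : P z) → z ≡ elem i → index z pz ≡ i
  index-of-elem {z} pz z≡elem = elem-injective (trans (elem-index z pz) z≡elem)

  index-cong : ∀ {z z'} (pz : P z) (pz' : P z') → z ≡ z' → index z pz ≡ index z' pz'
  index-cong {z} {z'} pz pz' refl = elem-injective (trans (elem-index z pz) (sym (elem-index z pz')))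

  index-injective : ∀ {z z'} {pz : P z} {pz' : P z'} → index z pz ≡ index z' pz' → z ≡ z'
  index-injective {z} {z'} {pz} {pz'} eq =
    trans (sym (elem-index z pz)) (trans (cong elem eq) (elem-index z' pz'))

enumerate : {P : Pred (Fin n) 0ℓ} (P? : Decidable P) → Enumeration P (count P?)
enumerate {n = zero} P? = record
  { elem = λ () ; elem∈ = λ () ; elem-injective = λ { {()} } ; index = λ () ; elem-index = λ () }
enumerate {n = suc n} {P} P? with P? zero | enumerate (P? ∘ suc)
... | yes p | E = record
  { elem = elem′ ; elem∈ = elem∈′ ; elem-injective = injective′ ; index = index′ ; elem-index = elem-index′ }
  where
  open Enumeration E
  elem′ : Fin (suc (count (P? ∘ suc))) → Fin (suc n)
  elem′ zero    = zero
  elem′ (suc i) = suc (elem i)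
  elem∈′ : ∀ i → P (elem′ i)
  elem∈′ zero    = p
  elem∈′ (suc i) = elem∈ i
  injective′ : ∀ {i j} → elem′ i ≡ elem′ j → i ≡ j
  injective′ {zero}  {zero}  _  = refl
  injective′ {suc i} {suc j} eq = cong suc (elem-injective (Fin.suc-injective eq))
  index′ : ∀ z → P z → Fin (suc (count (P? ∘ suc)))
  index′ zero    _  = zero
  index′ (suc z) pz = suc (index z pz)
  elem-index′ : ∀ z (pz : P z) → elem′ (index′ z pz) ≡ z
  elem-index′ zero    _  = refl
  elem-index′ (suc z) pz = cong suc (elem-index z pz)
... | no ¬p | E = record
  { elem = suc ∘ elem ; elem∈ = elem∈ ; elem-injective = elem-injective ∘ Fin.suc-injective
  ; index = index′ ; elem-index = elem-index′ }
  where
  open Enumeration E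
  index′ : ∀ z → P z → Fin (count (P? ∘ suc))
  index′ zero    p  = contradiction p ¬p
  index′ (suc z) pz = index z pz
  elem-index′ : ∀ z (pz : P z) → suc (elem (index′ z pz)) ≡ z
  elem-index′ zero    p  = contradiction p ¬p
  elem-index′ (suc z) pz = cong suc (elem-index z pz)

enumerateBy : {P : Pred (Fin n) 0ℓ} (P? : Decidable P) → count P? ≡ c → Enumeration P c
enumerateBy P? refl = enumerate P?

injection-onto : {P : Pred (Fin n) 0ℓ} {Q : Pred (Fin m) 0ℓ} (P? : Decidable P) (Q? : Decidable Q)
  (f : Fin n → Fin m) → (∀ {z} → P z → Q (f z)) →
  (∀ {z z'} → P z → P z' → f z ≡ f z' → z ≡ z') →
  count Q? ≤ count P? → ∀ {t} → Q t → ∃ λ z → P z × f z ≡ t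
injection-onto P? Q? f maps injective Q≤P {t} qt
  with any? (λ z → P? z ×-dec (f z ≟ t))
... | yes hit = hit
... | no miss =
  let i , j , i<j , collide = pigeonhole fewer squeeze
  in  contradiction (EP.elem-injective (injective (EP.elem∈ i) (EP.elem∈ j) (EQ.index-injective collide)))
                    (<⇒≢ i<j)
  where
  module EP = Enumeration (enumerate P?)
  module EQ = Enumeration (enumerate (Q? -[ t ]))
  squeeze : Fin (count P?) → Fin (count (Q? -[ t ]))
  squeeze i = EQ.index (f (EP.elem i)) (maps (EP.elem∈ i) , λ eq → miss (EP.elem i , EP.elem∈ i , eq))
  fewer : count (Q? -[ t ]) < count P?
  fewer = ≤-trans (≤-reflexive (sym (count-remove Q? qt))) Q≤P

⊆-by-count : {P Q : Pred (Fin n) 0ℓ} (P? : Decidable P) (Q? : Decidable Q) →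
  P ⊆ Q → count Q? ≤ count P? → Q ⊆ P
⊆-by-count P? Q? P⊆Q Q≤P qt
  with z , pz , refl ← injection-onto P? Q? (λ z → z) P⊆Q (λ _ _ eq → eq) Q≤P qt = pz

module LatticeStructure {v} (Γ : Graph v) (lam s : ℕ) (S : Subset v)
  (S-clique : IsClique Γ S) (S-one : ∀ x → x ∉ S → nbrsIn Γ S x ≡ 1)
  (S-size : ∣ S ∣ ≡ s) (2≤s : 2 ≤ s)
  (regular : ∀ x → degree Γ x ≡ lam + s)
  (edge-regular : ∀ x y → Adj Γ x y → commonNbrs Γ x y ≡ lam) where

  infix 4 _~_
  _~_ : Fin v → Fin v → Set
  _~_ = Adj Γ

  ~-sym : ∀ {x y} → x ~ y → y ~ x
  ~-sym = Graph.sym Γ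

  ~-irrefl : ∀ {x} → ¬ x ~ x
  ~-irrefl = irrefl Γ

  ~⇒≢ : ∀ {x y} → x ~ y → y ≢ x
  ~⇒≢ x~y refl = ~-irrefl x~y

  N? : (x : Fin v) → Decidable (x ~_)
  N? = adj? Γ

  S? : Decidable (_∈ S)
  S? = _∈? S

  common? : (x y : Fin v) → Decidable ((x ~_) ∩ (y ~_))
  common? x y = N? x ∩? N? y

  count-S : count S? ≡ s
  count-S = trans (sym (∣∣≡count S)) S-size

  count-common : ∀ {x y} → x ~ y → count (common? x y) ≡ lam
  count-common {x} {y} x~y = trans (count-cong (common? x y) _ (λ p → p) (λ p → p)) (edge-regular x y x~y)

  count-S-neighbours : ∀ {x} → x ∉ S → count (S? ∩? N? x) ≡ 1
  count-S-neighbours {x} x∉S = trans (count-cong (S? ∩? N? x) _ (λ p → p) (λ p → p)) (S-one x x∉S)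

  S-neighbour-unique : ∀ {x y y'} → x ∉ S → y ∈ S → y' ∈ S → x ~ y → x ~ y' → y ≡ y'
  S-neighbour-unique {x} x∉S y∈S y'∈S x~y x~y' =
    count-unique (S? ∩? N? x) (count-S-neighbours x∉S) (y∈S , x~y) (y'∈S , x~y')

  S-neighbour : ∀ {x} → x ∉ S → ∃ λ y → y ∈ S × x ~ y
  S-neighbour {x} x∉S = count-witness (S? ∩? N? x) (≤-reflexive (sym (count-S-neighbours x∉S)))

  common-in-S : ∀ {a b z} → a ∈ S → b ∈ S → a ≢ b → a ~ z → b ~ z → z ∈ S
  common-in-S {a} {b} {z} a∈S b∈S a≢b a~z b~z with z ∈? S
  ... | yes z∈S = z∈S
  ... | no z∉S  = contradiction (S-neighbour-unique z∉S a∈S b∈S (~-sym a~z) (~-sym b~z)) a≢b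

  two-in-S : ∃₂ λ a b → a ∈ S × b ∈ S × b ≢ a
  two-in-S = a , b , a∈S , b∈S , b≢a
    where
    a∈ : ∃ (_∈ S)
    a∈ = count-witness S? (≤-trans (s≤s z≤n) (≤-trans 2≤s (≤-reflexive (sym count-S))))
    a = proj₁ a∈
    a∈S = proj₂ a∈
    b∈ : ∃ ((_∈ S) ∩ ∁ (_≡ a))
    b∈ = count-witness (S? -[ a ])
           (s≤s⁻¹ (≤-trans 2≤s (≤-reflexive (trans (sym count-S) (count-remove S? a∈S)))))
    b = proj₁ b∈
    b∈S = proj₁ (proj₂ b∈)
    b≢a = proj₂ (proj₂ b∈)

  -- The clique S has exactly λ + 2 vertices: for distinct a, b ∈ S, the common
  -- neighbours of a and b are precisely the other vertices of S.
  s≡λ+2 : s ≡ suc (suc lam)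
  s≡λ+2 with a , b , a∈S , b∈S , b≢a ← two-in-S = begin
    s                                     ≡⟨ sym count-S ⟩
    count S?                              ≡⟨ count-remove S? a∈S ⟩
    suc (count (S? -[ a ]))               ≡⟨ cong suc (count-remove (S? -[ a ]) (b∈S , b≢a)) ⟩
    suc (suc (count (S? -[ a ] -[ b ])))  ≡⟨ cong (2 +_) (count-cong _ (common? a b) others⊆common common⊆others) ⟩
    suc (suc (count (common? a b)))       ≡⟨ cong (2 +_) (count-common (S-clique a b a∈S b∈S (b≢a ∘ sym))) ⟩
    suc (suc lam)                         ∎
    where
    open ≡-Reasoning
    others⊆common : ∀ {z} → (z ∈ S × z ≢ a) × z ≢ b → a ~ z × b ~ z
    others⊆common ((z∈S , z≢a) , z≢b) = S-clique _ _ a∈S z∈S (z≢a ∘ sym) , S-clique _ _ b∈S z∈S (z≢b ∘ sym)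
    common⊆others : ∀ {z} → a ~ z × b ~ z → (z ∈ S × z ≢ a) × z ≢ b
    common⊆others (a~z , b~z) = (common-in-S a∈S b∈S (b≢a ∘ sym) a~z b~z , ~⇒≢ a~z) , ~⇒≢ b~z

  count-S-without : ∀ {x} → x ∈ S → count (S? -[ x ]) ≡ suc lam
  count-S-without x∈S = suc-injective (trans (sym (count-remove S? x∈S)) (trans count-S s≡λ+2))

  -- By regularity (k = λ + s = 2λ + 2), a vertex with λ + 1 neighbours satisfying Q
  -- has λ + 1 neighbours not satisfying Q.
  complementary-neighbours : ∀ x {Q : Pred (Fin v) 0ℓ} (Q? : Decidable Q) →
    count (N? x ∩? Q?) ≡ suc lam → count (N? x ∩? ∁? Q?) ≡ suc lam
  complementary-neighbours x Q? inside = +-cancelˡ-≡ (suc lam) _ _ (begin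
    suc lam + count (N? x ∩? ∁? Q?)          ≡⟨ cong (_+ count (N? x ∩? ∁? Q?)) (sym inside) ⟩
    count (N? x ∩? Q?) + count (N? x ∩? ∁? Q?) ≡⟨ sym (count-split (N? x) Q?) ⟩
    count (N? x)                              ≡⟨ regular x ⟩
    lam + s                                   ≡⟨ cong (lam +_) s≡λ+2 ⟩
    lam + suc (suc lam)                       ≡⟨ +-suc lam (suc lam) ⟩
    suc lam + suc lam                         ∎)
    where open ≡-Reasoning

  outer? : (x : Fin v) → Decidable ((x ~_) ∩ ∁ (_∈ S))
  outer? x = N? x ∩? ∁? S?

  -- A vertex x of S is adjacent to the λ + 1 other vertices of S, hence to λ + 1 outside S.
  count-outer : ∀ {x} → x ∈ S → count (outer? x) ≡ suc lam
  count-outer {x} x∈S = complementary-neighbours x S?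
    (trans (count-cong (N? x ∩? S?) (S? -[ x ]) (λ (x~z , z∈S) → z∈S , ~⇒≢ x~z)
                                                (λ (z∈S , z≢x) → S-clique _ _ x∈S z∈S (z≢x ∘ sym) , z∈S))
           (count-S-without x∈S))

  Row : Fin v → Pred (Fin v) 0ℓ
  Row x z = z ≡ x ⊎ (x ~ z × z ∉ S)

  Row? : (x : Fin v) → Decidable (Row x)
  Row? x z = (z ≟ x) ⊎-dec outer? x z

  count-Row : ∀ {x} → x ∈ S → count (Row? x) ≡ suc (suc lam)
  count-Row {x} x∈S =
    trans (count-remove (Row? x) (inj₁ refl))
          (cong suc (trans (count-cong (Row? x -[ x ]) (outer? x) row⊆outer outer⊆row) (count-outer x∈S)))
    where
    row⊆outer : ∀ {z} → Row x z × z ≢ x → x ~ z × z ∉ S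
    row⊆outer (inj₁ z≡x , z≢x) = contradiction z≡x z≢x
    row⊆outer (inj₂ outer , _) = outer
    outer⊆row : ∀ {z} → x ~ z × z ∉ S → Row x z × z ≢ x
    outer⊆row (x~z , z∉S) = inj₂ (x~z , z∉S) , ~⇒≢ x~z

  -- The outer neighbours of x ∈ S are pairwise adjacent: the λ common neighbours of x and
  -- an outer neighbour y are outer neighbours of x other than y, and there are just λ of those.
  outer-clique : ∀ {x y y'} → x ∈ S → x ~ y → y ∉ S → x ~ y' → y' ∉ S → y' ≢ y → y ~ y'
  outer-clique {x} {y} x∈S x~y y∉S x~y' y'∉S y'≢y =
    proj₂ (⊆-by-count (common? x y) (outer? x -[ y ]) common⊆outer fewer ((x~y' , y'∉S) , y'≢y))
    where
    common⊆outer : ∀ {z} → x ~ z × y ~ z → (x ~ z × z ∉ S) × z ≢ y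
    common⊆outer (x~z , y~z) =
      (x~z , λ z∈S → ~⇒≢ x~z (sym (S-neighbour-unique y∉S x∈S z∈S (~-sym x~y) y~z))) , ~⇒≢ y~z
    fewer : count (outer? x -[ y ]) ≤ count (common? x y)
    fewer = ≤-reflexive (trans (suc-injective (trans (sym (count-remove (outer? x) (x~y , y∉S))) (count-outer x∈S)))
                               (sym (count-common x~y)))

  row-clique : ∀ {x a b} → x ∈ S → Row x a → Row x b → b ≢ a → a ~ b
  row-clique _   (inj₁ refl)        (inj₁ refl)        b≢a = contradiction refl b≢a
  row-clique _   (inj₁ refl)        (inj₂ (x~b , _))   _   = x~b
  row-clique _   (inj₂ (x~a , _))   (inj₁ refl)        _   = ~-sym x~a
  row-clique x∈S (inj₂ (x~a , a∉S)) (inj₂ (x~b , b∉S)) b≢a = outer-clique x∈S x~a a∉S x~b b∉S b≢a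

  row-of : ∀ w → ∃ λ x → x ∈ S × Row x w
  row-of w with w ∈? S
  ... | yes w∈S = w , w∈S , inj₁ refl
  ... | no w∉S with x , x∈S , w~x ← S-neighbour w∉S = x , x∈S , inj₂ (~-sym w~x , w∉S)

  rows-disjoint : ∀ {x x' w} → x ∈ S → x' ∈ S → Row x w → Row x' w → x ≡ x'
  rows-disjoint _   _    (inj₁ refl)        (inj₁ refl)         = refl
  rows-disjoint x∈S _    (inj₁ refl)        (inj₂ (_ , w∉S))    = contradiction x∈S w∉S
  rows-disjoint _   x'∈S (inj₂ (_ , w∉S))   (inj₁ refl)         = contradiction x'∈S w∉S
  rows-disjoint x∈S x'∈S (inj₂ (x~w , w∉S)) (inj₂ (x'~w , _))   =
    S-neighbour-unique w∉S x∈S x'∈S (~-sym x~w) (~-sym x'~w)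

  row : Fin v → Fin v
  row w = proj₁ (row-of w)

  row∈S : ∀ w → row w ∈ S
  row∈S w = proj₁ (proj₂ (row-of w))

  in-row : ∀ w → Row (row w) w
  in-row w = proj₂ (proj₂ (row-of w))

  row-unique : ∀ {x w} → x ∈ S → Row x w → row w ≡ x
  row-unique {w = w} x∈S w∈Row = rows-disjoint (row∈S w) x∈S (in-row w) w∈Row

  in-row-of : ∀ {w z} → row w ≡ row z → Row (row w) z
  in-row-of {z = z} eq = subst (λ x → Row x z) (sym eq) (in-row z)

  same-row⇒adjacent : ∀ {w z} → row w ≡ row z → z ≢ w → w ~ z
  same-row⇒adjacent {w} {z} eq z≢w = row-clique (row∈S w) (in-row w) (in-row-of {w} {z} eq) z≢w

  -- A vertex w outside a row has at most one neighbour in it: two such neighbours u, u'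
  -- would have the λ other vertices of their row and also w as common neighbours.
  one-neighbour-per-row : ∀ {w u u'} → w ~ u → w ~ u' → row u ≡ row u' → row w ≢ row u → u ≡ u'
  one-neighbour-per-row {w} {u} {u'} w~u w~u' same-row w-elsewhere with u' ≟ u
  ... | yes u'≡u = sym u'≡u
  ... | no u'≢u  = contradiction too-many 1+n≰n
    where
    open ≤-Reasoning
    u'∈Row : Row (row u) u'
    u'∈Row = in-row-of {u} {u'} same-row
    count-rest : count (Row? (row u) -[ u ] -[ u' ]) ≡ lam
    count-rest = suc-injective (suc-injective (begin-equality
      suc (suc (count (Row? (row u) -[ u ] -[ u' ])))
        ≡⟨ sym (trans (count-remove (Row? (row u)) (in-row u)) (cong suc (count-remove (Row? (row u) -[ u ]) (u'∈Row , u'≢u)))) ⟩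
      count (Row? (row u))
        ≡⟨ count-Row (row∈S u) ⟩
      suc (suc lam) ∎))
    rest⊆common : ∀ {z} → (Row (row u) z × z ≢ u) × z ≢ u' → (u ~ z × u' ~ z) × z ≢ w
    rest⊆common ((z∈Row , z≢u) , z≢u') =
      (row-clique (row∈S u) (in-row u) z∈Row z≢u , row-clique (row∈S u) u'∈Row z∈Row z≢u') ,
      λ { refl → w-elsewhere (row-unique (row∈S u) z∈Row) }
    too-many : suc lam ≤ lam
    too-many = begin
      suc lam                                            ≡⟨ cong suc (sym count-rest) ⟩
      suc (count (Row? (row u) -[ u ] -[ u' ]))         ≤⟨ s≤s (count-mono _ (common? u u' -[ w ]) rest⊆common) ⟩
      suc (count (common? u u' -[ w ]))                 ≡⟨ sym (count-remove (common? u u') (~-sym w~u , ~-sym w~u')) ⟩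
      count (common? u u')                              ≡⟨ count-common (same-row⇒adjacent same-row (u'≢u)) ⟩
      lam                                               ∎

  Across : Fin v → Pred (Fin v) 0ℓ
  Across w z = w ~ z × row w ≢ row z

  Across? : (w : Fin v) → Decidable (Across w)
  Across? w = N? w ∩? ∁? (λ z → row w ≟ row z)

  -- w has λ + 1 neighbours in its own row (the rest of the row), hence λ + 1 across.
  count-Across : ∀ w → count (Across? w) ≡ suc lam
  count-Across w = complementary-neighbours w (λ z → row w ≟ row z)
    (trans (count-cong (N? w ∩? (λ z → row w ≟ row z)) (Row? (row w) -[ w ])
                       (λ {z} (w~z , eq) → in-row-of {w} {z} eq , ~⇒≢ w~z)
                       (λ {z} (z∈Row , z≢w) → let eq = sym (row-unique (row∈S w) z∈Row)
                                              in same-row⇒adjacent eq z≢w , eq))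
           (suc-injective (trans (sym (count-remove (Row? (row w)) (in-row w))) (count-Row (row∈S w)))))

  -- Since the λ + 1 neighbours across lie in distinct rows and there are λ + 1 other
  -- rows, w has a neighbour in every other row.
  meets-every-row : ∀ w {x} → x ∈ S → row w ≢ x → ∃ λ z → w ~ z × row z ≡ x
  meets-every-row w x∈S row≢x =
    map₂ (map₁ proj₁) (injection-onto (Across? w) (S? -[ row w ]) row
      (λ {z} (_ , row≢) → row∈S z , row≢ ∘ sym)
      (λ (w~z , row≢) (w~z' , _) eq → one-neighbour-per-row w~z w~z' eq row≢)
      (≤-reflexive (trans (count-S-without (row∈S w)) (sym (count-Across w))))
      (x∈S , row≢x ∘ sym))

  -- Two neighbours of w in two further distinct rows are adjacent: the λ common neighbours
  -- of w and u are among the λ neighbours of w across from both w and u.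
  across-triangle : ∀ {w u u'} → Across w u → Across w u' → row u ≢ row u' → u ~ u'
  across-triangle {w} {u} {u'} (w~u , w≢u) across-u' u≢u' =
    proj₂ (⊆-by-count (common? w u) (Across? w ∩? ∁? same-row-as-u?) common⊆across fewer (across-u' , u≢u'))
    where
    same-row-as-u? : Decidable (λ z → row u ≡ row z)
    same-row-as-u? z = row u ≟ row z
    common⊆across : ∀ {z} → w ~ z × u ~ z → Across w z × row u ≢ row z
    common⊆across (w~z , u~z) =
      (w~z , λ eq → ~⇒≢ w~z (sym (one-neighbour-per-row (~-sym w~u) u~z eq (w≢u ∘ sym)))) ,
      λ eq → ~⇒≢ u~z (sym (one-neighbour-per-row w~u w~z eq w≢u))
    only-u : count (Across? w ∩? same-row-as-u?) ≡ 1
    only-u = trans (count-cong _ (_≟ u) (λ ((w~z , _) , eq) → sym (one-neighbour-per-row w~u w~z eq w≢u))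
                                        (λ { refl → (w~u , w≢u) , refl }))
                   (count-singleton u)
    fewer : count (Across? w ∩? ∁? same-row-as-u?) ≤ count (common? w u)
    fewer = ≤-reflexive (suc-injective (begin
      suc (count (Across? w ∩? ∁? same-row-as-u?))
        ≡⟨ cong (_+ count (Across? w ∩? ∁? same-row-as-u?)) (sym only-u) ⟩
      count (Across? w ∩? same-row-as-u?) + count (Across? w ∩? ∁? same-row-as-u?)
        ≡⟨ sym (count-split (Across? w) same-row-as-u?) ⟩
      count (Across? w)
        ≡⟨ count-Across w ⟩
      suc lam
        ≡⟨ cong suc (sym (count-common w~u)) ⟩
      suc (count (common? w u)) ∎))
      where open ≡-Reasoning

  Column : Fin v → Fin v → Set
  Column w z = w ≡ z ⊎ Across w z

  column-sym : ∀ {w z} → Column w z → Column z w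
  column-sym (inj₁ refl)         = inj₁ refl
  column-sym (inj₂ (w~z , row≢)) = inj₂ (~-sym w~z , row≢ ∘ sym)

  -- Lying in the same column is transitive by the triangle property of edges across rows.
  column-trans : ∀ {w u u'} → Column w u → Column u u' → Column w u'
  column-trans (inj₁ refl) c = c
  column-trans c (inj₁ refl) = c
  column-trans {w} {u} {u'} (inj₂ (w~u , w≢u)) (inj₂ (u~u' , u≢u')) with w ≟ u'
  ... | yes w≡u' = inj₁ w≡u'
  ... | no w≢u' with row w ≟ row u'
  ...   | yes eq   = contradiction (one-neighbour-per-row (~-sym w~u) u~u' eq (w≢u ∘ sym)) w≢u'
  ...   | no row≢  = inj₂ (across-triangle (~-sym w~u , w≢u ∘ sym) (u~u' , u≢u') row≢ , row≢)

  base : Fin v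
  base = proj₁ two-in-S

  base∈S : base ∈ S
  base∈S = proj₁ (proj₂ (proj₂ two-in-S))

  column-of : ∀ w → ∃ λ z → Row base z × Column w z
  column-of w with row w ≟ base
  ... | yes eq   = w , subst (λ x → Row x w) eq (in-row w) , inj₁ refl
  ... | no row≢  = let z , w~z , row-z = meets-every-row w base∈S row≢ in
    z , subst (λ x → Row x z) row-z (in-row z) , inj₂ (w~z , λ eq → row≢ (trans eq row-z))

  columns-disjoint : ∀ {w z z'} → Row base z → Row base z' → Column w z → Column w z' → z ≡ z'
  columns-disjoint z∈Row z'∈Row c c' with column-trans (column-sym c) c'
  ... | inj₁ z≡z'       = z≡z'
  ... | inj₂ (_ , row≢) = contradiction (trans (row-unique base∈S z∈Row) (sym (row-unique base∈S z'∈Row))) row≢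

  column : Fin v → Fin v
  column w = proj₁ (column-of w)

  column∈base : ∀ w → Row base (column w)
  column∈base w = proj₁ (proj₂ (column-of w))

  in-column : ∀ w → Column w (column w)
  in-column w = proj₂ (proj₂ (column-of w))

  column-unique : ∀ {w z} → Row base z → Column w z → column w ≡ z
  column-unique {w} z∈Row c = columns-disjoint (column∈base w) z∈Row (in-column w) c

  same-column : ∀ {w w'} → column w ≡ column w' → Column w w'
  same-column {w} {w'} eq = column-trans (in-column w) (column-sym (subst (Column w') (sym eq) (in-column w')))

  row-column-injective : ∀ {w w'} → row w ≡ row w' → column w ≡ column w' → w ≡ w'
  row-column-injective {w} {w'} row≡ col≡ with same-column {w} {w'} col≡
  ... | inj₁ w≡w'       = w≡w'
  ... | inj₂ (_ , row≢) = contradiction row≡ row≢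

  row-column-surjective : ∀ {x z} → x ∈ S → Row base z → ∃ λ w → row w ≡ x × column w ≡ z
  row-column-surjective {x} {z} x∈S z∈Row with x ≟ base | row-unique base∈S z∈Row
  ... | yes refl    | row-z = z , row-z , column-unique z∈Row (inj₁ refl)
  ... | no x≢base   | row-z = let u , z~u , row-u = meets-every-row z x∈S (λ eq → x≢base (trans (sym eq) row-z)) in
    u , row-u , column-unique z∈Row (inj₂ (~-sym z~u , λ eq → x≢base (trans (sym row-u) (trans eq row-z))))

  LatticeAdj : Fin v → Fin v → Set
  LatticeAdj w w' = (row w ≡ row w' × column w ≢ column w') ⊎ (row w ≢ row w' × column w ≡ column w')

  adjacent⇒lattice : ∀ {w w'} → w ~ w' → LatticeAdj w w'
  adjacent⇒lattice {w} {w'} w~w' with row w ≟ row w'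
  ... | yes row≡ = inj₁ (row≡ , λ col≡ → not-column (same-column col≡))
    where
    not-column : ¬ Column w w'
    not-column (inj₁ refl)       = ~-irrefl w~w'
    not-column (inj₂ (_ , row≢)) = row≢ row≡
  ... | no row≢  = inj₂ (row≢ , column-unique (column∈base w') (column-trans (inj₂ (w~w' , row≢)) (in-column w')))

  lattice⇒adjacent : ∀ {w w'} → LatticeAdj w w' → w ~ w'
  lattice⇒adjacent (inj₁ (row≡ , col≢)) = same-row⇒adjacent row≡ λ { refl → col≢ refl }
  lattice⇒adjacent {w} {w'} (inj₂ (row≢ , col≡)) with same-column {w} {w'} col≡
  ... | inj₁ refl          = contradiction refl row≢
  ... | inj₂ (w~w' , _)    = w~w'

  module RowIndex    = Enumeration (enumerateBy S? count-S)
  module ColumnIndex = Enumeration (enumerateBy (Row? base) (trans (count-Row base∈S) (sym s≡λ+2)))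

  row-index : Fin v → Fin s
  row-index w = RowIndex.index (row w) (row∈S w)

  column-index : Fin v → Fin s
  column-index w = ColumnIndex.index (column w) (column∈base w)

  coordinates : Fin v → Fin s × Fin s
  coordinates w = row-index w , column-index w

  coordinates-injective : ∀ {w w'} → coordinates w ≡ coordinates w' → w ≡ w'
  coordinates-injective {w} {w'} eq =
    row-column-injective {w} {w'} (RowIndex.index-injective (cong proj₁ eq)) (ColumnIndex.index-injective (cong proj₂ eq))

  coordinates-surjective : ∀ ij → ∃ λ w → ∀ {w'} → w' ≡ w → coordinates w' ≡ ij
  coordinates-surjective (i , j) =
    let w , row≡ , col≡ = row-column-surjective (RowIndex.elem∈ i) (ColumnIndex.elem∈ j) in
    w , λ { refl → cong₂ _,_ (RowIndex.index-of-elem (row∈S w) row≡) (ColumnIndex.index-of-elem (column∈base w) col≡) }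

  adjacent⇔L2 : ∀ w w' → (w ~ w' → L2Adj (coordinates w) (coordinates w')) × (L2Adj (coordinates w) (coordinates w') → w ~ w')
  adjacent⇔L2 w w' = to-L2 ∘ adjacent⇒lattice , lattice⇒adjacent {w} {w'} ∘ from-L2
    where
    row→index : row w ≡ row w' → row-index w ≡ row-index w'
    row→index = RowIndex.index-cong (row∈S w) (row∈S w')
    index→row : row-index w ≡ row-index w' → row w ≡ row w'
    index→row = RowIndex.index-injective
    column→index : column w ≡ column w' → column-index w ≡ column-index w'
    column→index = ColumnIndex.index-cong (column∈base w) (column∈base w')
    index→column : column-index w ≡ column-index w' → column w ≡ column w'
    index→column = ColumnIndex.index-injective
    to-L2 : LatticeAdj w w' → L2Adj (coordinates w) (coordinates w')
    to-L2 = map⊎ (map row→index (_∘ index→column)) (map (_∘ index→row) column→index)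
    from-L2 : L2Adj (coordinates w) (coordinates w') → LatticeAdj w w'
    from-L2 = map⊎ (map index→row (_∘ column→index)) (map (_∘ row→index) index→column)

  isomorphism : IsoToL2 Γ s
  isomorphism = mk⤖ {to = coordinates} (coordinates-injective , coordinates-surjective) , adjacent⇔L2

lemma16 : ∀ {v} (Γ : Graph v) (k lam m s : ℕ) →
    InNG Γ k lam m s →
    k + m ≡ lam + s + 1 →
    m ≡ 1 →
    IsoToL2 Γ s
lemma16 Γ k lam m s (_ , (_ , regular , edge-regular) , 2≤s , S , (clique , _ , one-neighbour) , size) k+m≡ refl =
  LatticeStructure.isomorphism Γ lam s S clique one-neighbour size 2≤s
    (λ x → trans (regular x) k≡λ+s) edge-regular
  where
  k≡λ+s : k ≡ lam + s
  k≡λ+s = +-cancelʳ-≡ 1 k (lam + s) k+m≡
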